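{- Let $\mathcal{X}$ be a finite data universe, let $\mathcal{D}\in\mathbb{N}^{|\mathcal{X}|}$ be a database, let $\mathcal{Q}$ be a class of linear queries, and let $\alpha>0$. Then every $(\mathbf{U}^{FK}_{\alpha},\mathcal{D},\mathcal{Q},\alpha,C)$-database update sequence satisfies $C\le B(\alpha)$ where $B(\alpha)=\frac{\|\mathcal{D}\|_2^2\,|\mathcal{X}|}{\alpha^2}$; i.e. $\mathbf{U}^{FK}_{\alpha}$ is a $B(\alpha)$-iterative database construction for $\mathcal{Q}$ with this $B$.
   Context: A database is a histogram $\mathcal{D}\in\mathbb{N}^{|\mathcal{X}|}$, and $\|\mathcal{D}\|_2^2=\sum_{i\in\mathcal{X}}\mathcal{D}(i)^2$. A linear query is a vector $Q\in[0,1]^{|\mathcal{X}|}$, evaluated on any vector $v\in\mathbb{R}^{|\mathcal{X}|}$ as $Q(v)=\langle Q,v\rangle$. The Frieze/Kannan update rule $\mathbf{U}^{FK}_{\alpha}:\mathbb{R}^{|\mathcal{X}|}\times\mathcal{Q}\times\mathbb{R}\to\mathbb{R}^{|\mathcal{X}|}$: its designated initial data structure $\mathbf{U}^{FK}_{\alpha}(\emptyset,\cdot,\cdot)$ is the zero vector; on input a data structure $\mathcal{D}'\in\mathbb{R}^{|\mathcal{X}|}$, a query $Q$ and a real $\widehat a$: if $Q(\mathcal{D}')-\widehat a>0$ it outputs $\mathcal{D}'-\frac{\alpha}{|\mathcal{X}|}Q$, and if $Q(\mathcal{D}')-\widehat a<0$ it outputs $\mathcal{D}'+\frac{\alpha}{|\mathcal{X}|}Q$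 (vector addition). Database update sequences: for a database $\mathcal{D}$, $\alpha>0$ and integer $C$, a sequence $\{(\mathcal{D}^{(t)},Q^{(t)},\widehat a^{(t)})\}_{t=1}^{C}$ with $\mathcal{D}^{(t)}\in\mathbb{R}^{|\mathcal{X}|}$, $Q^{(t)}\in\mathcal{Q}$, $\widehat a^{(t)}\in\mathbb{R}$ is a $(\mathbf{U},\mathcal{D},\mathcal{Q},\alpha,C)$-database update sequence if: (1) $\mathcal{D}^{(1)}=\mathbf{U}(\emptyset,\cdot,\cdot)$; (2) $|Q^{(t)}(\mathcal{D})-Q^{(t)}(\mathcal{D}^{(t)})|\ge\alpha$ for all $t\le C$; (3) $|Q^{(t)}(\mathcal{D})-\widehat a^{(t)}|<\alpha$ for all $t\le C$; (4) $\mathcal{D}^{(t+1)}=\mathbf{U}(\mathcal{D}^{(t)},Q^{(t)},\widehat a^{(t)})$ for all $t\le C-1$. -}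

module Defs where

open import Level using (0ℓ)
open import Data.Nat as ℕ using (ℕ; zero; suc)
open import Data.Fin using (Fin; zero; suc)
open import Data.Sum using (_⊎_)
open import Data.Product using (_×_)
open import Relation.Binary.PropositionalEquality using (_≡_; _≢_)
open import Relation.Binary.Structures using (IsStrictTotalOrder)
open import Relation.Binary.Definitions using (tri<; tri≈; tri>)
open import Algebra.Structures using (IsCommutativeRing)

-- An ordered field (with propositional equality on the carrier).
-- The real numbers ℝ are an instance; the theorem is stated for every
-- ordered field, in particular for ℝ.
record OrderedField : Set₁ where
  infixl 6 _+_
  infixl 7 _*_
  infix  8 -_
  infix  4 _<_
  field
    Carrier : Set
    _+_ _*_ : Carrier → Carrier → Carrier
    -_      : Carrier → Carrier
    0# 1#   : Carrier
    _⁻¹     : Carrier → Carrier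
    _<_     : Carrier → Carrier → Set
    isCommutativeRing : IsCommutativeRing _≡_ _+_ _*_ -_ 0# 1#
    ⁻¹-inverse : ∀ x → x ≢ 0# → x * (x ⁻¹) ≡ 1#
    0≢1 : 0# ≢ 1#
    isStrictTotalOrder : IsStrictTotalOrder _≡_ _<_
    +-mono-< : ∀ a b c → a < b → a + c < b + c
    *-pos : ∀ a b → 0# < a → 0# < b → 0# < a * b

module _ (F : OrderedField) where
  open OrderedField F
  open IsStrictTotalOrder isStrictTotalOrder using (compare)

  infix 4 _≤_
  _≤_ : Carrier → Carrier → Set
  a ≤ b = a < b ⊎ a ≡ b

  _-_ : Carrier → Carrier → Carrier
  a - b = a + (- b)

  _/_ : Carrier → Carrier → Carrier
  a / b = a * (b ⁻¹)

  ∣_∣ : Carrier → Carrier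
  ∣ x ∣ with compare x 0#
  ... | tri< _ _ _ = - x
  ... | tri≈ _ _ _ = x
  ... | tri> _ _ _ = x

  fromℕ : ℕ → Carrier
  fromℕ zero    = 0#
  fromℕ (suc n) = 1# + fromℕ n

  -- vectors in F^{|X|} with |X| = n, indexed by the universe Fin n
  Vect : ℕ → Set
  Vect n = Fin n → Carrier

  sumF : ∀ {n} → (Fin n → Carrier) → Carrier
  sumF {zero}  f = 0#
  sumF {suc n} f = f zero + sumF (λ i → f (suc i))

  ⟨_,_⟩ : ∀ {n} → Vect n → Vect n → Carrier
  ⟨ Q , v ⟩ = sumF (λ i → Q i * v i)

  -- a database is a histogram in ℕ^{|X|}, viewed as a vector in F^{|X|}
  embedDB : ∀ {n} → (Fin n → ℕ) → Vect n
  embedDB D i = fromℕ (D i)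

  sqNorm : ∀ {n} → (Fin n → ℕ) → Carrier
  sqNorm D = sumF (λ i → fromℕ (D i) * fromℕ (D i))

  IsLinearQuery : ∀ {n} → Vect n → Set
  IsLinearQuery {n} Q = (i : Fin n) → (0# ≤ Q i) × (Q i ≤ 1#)

  initFK : ∀ {n} → Vect n
  initFK _ = 0#

  -- U(D', Q, â).  The paper leaves the case Q(D') = â unspecified; we return
  -- D' unchanged there (this case can never occur inside an update sequence,
  -- by conditions (2) and (3)).
  stepFK : ∀ {n} → Carrier → Vect n → Vect n → Carrier → Vect n
  stepFK {n} α D' Q â with compare (⟨ Q , D' ⟩ - â) 0#
  ... | tri> _ _ _ = λ i → D' i - ((α / fromℕ n) * Q i)
  ... | tri< _ _ _ = λ i → D' i + ((α / fromℕ n) * Q i)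
  ... | tri≈ _ _ _ = D'

  -- (U^{FK}_α, D, 𝒬, α, C)-database update sequence, with the entries
  -- (D^(t), Q^(t), â^(t)) for t = 1..C given as ℕ-indexed families
  -- (values outside 1..C are irrelevant).
  record IsFKUpdateSequence {n : ℕ} (D : Fin n → ℕ) (𝒬 : Vect n → Set)
      (α : Carrier) (C : ℕ)
      (Ds : ℕ → Vect n) (Qs : ℕ → Vect n) (as : ℕ → Carrier) : Set where
    field
      queries-in-𝒬 : ∀ t → 1 ℕ.≤ t → t ℕ.≤ C → 𝒬 (Qs t)
      cond1 : Ds 1 ≡ initFK
      cond2 : ∀ t → 1 ℕ.≤ t → t ℕ.≤ C →
              α ≤ ∣ ⟨ Qs t , embedDB D ⟩ - ⟨ Qs t , Ds t ⟩ ∣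
      cond3 : ∀ t → 1 ℕ.≤ t → t ℕ.≤ C →
              ∣ ⟨ Qs t , embedDB D ⟩ - as t ∣ < α
      cond4 : ∀ t → 1 ℕ.≤ t → t ℕ.≤ C ℕ.∸ 1 →
              Ds (suc t) ≡ stepFK α (Ds t) (Qs t) (as t)

  B : ∀ {n} → (Fin n → ℕ) → Carrier → Carrier
  B {n} D α = (sqNorm D * fromℕ n) / (α * α)

module Submission where

-- Measure a data structure v by its squared distance
-- Ψ(v) = Σᵢ (Dᵢ - vᵢ)² to the database.  An FK step moves v to v + e·Q with
-- e = ±c, c = α/n, and expanding the square gives
--   Ψ(v + eQ) = Ψ(v) - 2e (Q(D) - Q(v)) + e² ⟨Q,Q⟩.
-- Conditions (2) and (3) of an update sequence force the sign of e to be the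
-- sign of Q(D) - Q(v), so e (Q(D) - Q(v)) ≥ cα; and ⟨Q,Q⟩ ≤ n for a linear
-- query gives e² ⟨Q,Q⟩ ≤ c² n = cα.  So every step lowers Ψ by at least
-- cα = α²/n.  As Ψ starts at Ψ(0) = ‖D‖² and stays nonnegative, telescoping
-- gives C·α²/n ≤ ‖D‖², which is C ≤ B(α).  A universe of size 0 admits no
-- step at all.

open import Defs
  using (OrderedField; Vect; IsLinearQuery; IsFKUpdateSequence; fromℕ; B; embedDB; sqNorm; initFK; stepFK)
open import Data.Nat using (ℕ; zero; suc)
open import Data.Fin using (Fin; zero; suc)
open import Algebra.Bundles using (CommutativeRing; RawRing)
open import Algebra.Structures using (IsCommutativeRing)
open import Algebra.Solver.Ring.AlmostCommutativeRing
  using (fromCommutativeRing; _-Raw-AlmostCommutative⟶_)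
open import Data.Empty using (⊥-elim)
open import Data.Maybe using (Maybe; just; nothing)
import Data.Nat as ℕ
import Data.Nat.Properties as ℕ
open import Data.Product using (_×_; _,_; proj₁; proj₂)
open import Data.Product.Properties using (≡-dec)
open import Data.Sum using (_⊎_; inj₁; inj₂)
open import Relation.Binary.Bundles using (StrictTotalOrder)
open import Relation.Binary.Definitions using (tri<; tri≈; tri>)
import Relation.Binary.PropositionalEquality as ≡
open import Relation.Binary.Structures using (IsStrictTotalOrder)
open import Relation.Nullary using (¬_; yes; no)

-- The integer m - n is represented by the
-- pair (m , n); cancel removes common successors, so every integer has one
-- representative in normal form and syntactic equality of representatives
-- decides equality of coefficients.
module IntegerCoefficientSolver {c ℓ} (R : CommutativeRing c ℓ) where
  open CommutativeRing R hiding (zero)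
  open import Algebra.Properties.Ring ring
    using (-‿anti-homo-+; -‿involutive; -‿+-comm; [y-z]x≈yx-zx; x[y-z]≈xy-xz; -0#≈0#)
  open import Algebra.Properties.Semiring.Mult.TCOptimised semiring
    using (1+×; ×-homo-+; ×1-homo-*) renaming (_×_ to _×ᴿ_)
  open import Algebra.Properties.CommutativeSemigroup +-commutativeSemigroup
    using (interchange)
  open import Relation.Binary.Reasoning.Setoid setoid

  Difference : Set
  Difference = ℕ × ℕ

  cancel : ℕ → ℕ → Difference
  cancel (suc m) (suc n) = cancel m n
  cancel m       zero    = m , zero
  cancel zero    (suc n) = zero , suc n

  value : Difference → Carrier
  value (m , n) = m ×ᴿ 1# + - (n ×ᴿ 1#)

  -- the same value, computed so that the representatives of 0, 1 and -1
  -- evaluate to 0#, 1# and - 1# on the nose: the solver compares normal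
  -- forms up to definitional equality
  ⟦_⟧ᵈ : Difference → Carrier
  ⟦ m , zero ⟧ᵈ = m ×ᴿ 1#
  ⟦ zero , n ⟧ᵈ = - (n ×ᴿ 1#)
  ⟦ x ⟧ᵈ        = value x

  ⟦⟧ᵈ≈value : ∀ x → ⟦ x ⟧ᵈ ≈ value x
  ⟦⟧ᵈ≈value (m , zero)      = sym (trans (+-congˡ -0#≈0#) (+-identityʳ _))
  ⟦⟧ᵈ≈value (zero , suc n)  = sym (+-identityˡ _)
  ⟦⟧ᵈ≈value (suc m , suc n) = refl

  sub-+ : ∀ a b c d → (a + c) + - (b + d) ≈ (a + - b) + (c + - d)
  sub-+ a b c d = trans (+-congˡ (sym (-‿+-comm b d))) (interchange a c (- b) (- d))

  sub-swap : ∀ a b → b + - a ≈ - (a + - b)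
  sub-swap a b = sym (trans (-‿anti-homo-+ a (- b)) (+-congʳ (-‿involutive b)))

  sub-* : ∀ a b c d → (a * c + b * d) + - (a * d + b * c) ≈ (a + - b) * (c + - d)
  sub-* a b c d = sym (begin
    (a + - b) * (c + - d)                       ≈⟨ [y-z]x≈yx-zx (c + - d) a b ⟩
    a * (c + - d) + - (b * (c + - d))           ≈⟨ +-cong (x[y-z]≈xy-xz a c d) (-‿cong (x[y-z]≈xy-xz b c d)) ⟩
    (a * c + - (a * d)) + - (b * c + - (b * d)) ≈⟨ +-congˡ (sym (sub-swap (b * c) (b * d))) ⟩
    (a * c + - (a * d)) + (b * d + - (b * c))   ≈⟨ interchange _ _ _ _ ⟩
    (a * c + b * d) + (- (a * d) + - (b * c))   ≈⟨ +-congˡ (-‿+-comm (a * d) (b * c)) ⟩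
    (a * c + b * d) + - (a * d + b * c)         ∎)

  cancel-sound : ∀ m n → ⟦ cancel m n ⟧ᵈ ≈ value (m , n)
  cancel-sound (suc m) (suc n) = begin
    ⟦ cancel m n ⟧ᵈ                       ≈⟨ cancel-sound m n ⟩
    m ×ᴿ 1# + - (n ×ᴿ 1#)                 ≈⟨ +-identityˡ _ ⟨
    0# + (m ×ᴿ 1# + - (n ×ᴿ 1#))          ≈⟨ +-congʳ (-‿inverseʳ 1#) ⟨
    (1# + - 1#) + (m ×ᴿ 1# + - (n ×ᴿ 1#)) ≈⟨ sub-+ 1# 1# (m ×ᴿ 1#) (n ×ᴿ 1#) ⟨
    (1# + m ×ᴿ 1#) + - (1# + n ×ᴿ 1#)     ≈⟨ +-cong (1+× m 1#) (-‿cong (1+× n 1#)) ⟨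
    value (suc m , suc n)                 ∎
  cancel-sound zero    zero    = ⟦⟧ᵈ≈value (zero , zero)
  cancel-sound (suc m) zero    = ⟦⟧ᵈ≈value (suc m , zero)
  cancel-sound zero    (suc n) = ⟦⟧ᵈ≈value (zero , suc n)

  differences : RawRing _ _
  differences = record
    { Carrier = Difference ; _≈_ = ≡._≡_
    ; _+_ = λ { (a , b) (c , d) → cancel (a ℕ.+ c) (b ℕ.+ d) }
    ; _*_ = λ { (a , b) (c , d) → cancel (a ℕ.* c ℕ.+ b ℕ.* d) (a ℕ.* d ℕ.+ b ℕ.* c) }
    ; -_  = λ { (a , b) → b , a }
    ; 0#  = 0 , 0
    ; 1#  = 1 , 0
    }

  value-+ : ∀ a b c d → value (a ℕ.+ c , b ℕ.+ d) ≈ value (a , b) + value (c , d)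
  value-+ a b c d = trans (+-cong (×-homo-+ 1# a c) (-‿cong (×-homo-+ 1# b d))) (sub-+ _ _ _ _)

  value-* : ∀ a b c d →
    value (a ℕ.* c ℕ.+ b ℕ.* d , a ℕ.* d ℕ.+ b ℕ.* c) ≈ value (a , b) * value (c , d)
  value-* a b c d = trans (+-cong (sum-of-products a c b d) (-‿cong (sum-of-products a d b c))) (sub-* _ _ _ _)
    where
    sum-of-products : ∀ p q r s →
      (p ℕ.* q ℕ.+ r ℕ.* s) ×ᴿ 1# ≈ (p ×ᴿ 1#) * (q ×ᴿ 1#) + (r ×ᴿ 1#) * (s ×ᴿ 1#)
    sum-of-products p q r s =
      trans (×-homo-+ 1# (p ℕ.* q) (r ℕ.* s)) (+-cong (×1-homo-* p q) (×1-homo-* r s))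

  ⟦⟧ᵈ-homomorphism : differences -Raw-AlmostCommutative⟶ fromCommutativeRing R
  ⟦⟧ᵈ-homomorphism = record
    { ⟦_⟧    = ⟦_⟧ᵈ
    ; +-homo = λ { (a , b) (c , d) → trans (cancel-sound (a ℕ.+ c) (b ℕ.+ d))
                   (trans (value-+ a b c d) (sym (+-cong (⟦⟧ᵈ≈value (a , b)) (⟦⟧ᵈ≈value (c , d))))) }
    ; *-homo = λ { (a , b) (c , d) → trans (cancel-sound (a ℕ.* c ℕ.+ b ℕ.* d) (a ℕ.* d ℕ.+ b ℕ.* c))
                   (trans (value-* a b c d) (sym (*-cong (⟦⟧ᵈ≈value (a , b)) (⟦⟧ᵈ≈value (c , d))))) }
    ; -‿homo = λ { (a , b) → trans (⟦⟧ᵈ≈value (b , a))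
                   (trans (sub-swap (a ×ᴿ 1#) (b ×ᴿ 1#)) (-‿cong (sym (⟦⟧ᵈ≈value (a , b))))) }
    ; 0-homo = refl
    ; 1-homo = refl
    }

  -- equal normal forms are equal coefficients (the solver needs no more)
  coefficient-equality : ∀ x y → Maybe (⟦ x ⟧ᵈ ≈ ⟦ y ⟧ᵈ)
  coefficient-equality x y with ≡-dec ℕ._≟_ ℕ._≟_ x y
  ... | yes ≡.refl = just refl
  ... | no _       = nothing

  open import Algebra.Solver.Ring differences (fromCommutativeRing R) ⟦⟧ᵈ-homomorphism coefficient-equality
    public

module OrderedFieldProperties (F : OrderedField) where
  open OrderedField F
  open ≡ using (_≡_; _≢_; refl; sym; trans; cong; cong₂; subst; subst₂)
  open IsStrictTotalOrder isStrictTotalOrder using (compare) renaming (irrefl to <-irrefl)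

  commutativeRing : CommutativeRing _ _
  commutativeRing = record { isCommutativeRing = isCommutativeRing }

  strictTotalOrder : StrictTotalOrder _ _ _
  strictTotalOrder = record { isStrictTotalOrder = isStrictTotalOrder }

  open IntegerCoefficientSolver commutativeRing using (solve; _:+_; _:*_; :-_; _:=_; con)
  open import Relation.Binary.Reasoning.StrictPartialOrder (StrictTotalOrder.strictPartialOrder strictTotalOrder)

  infix  4 _≤_
  infixl 6 _-_
  infixl 7 _/_

  _≤_ : Carrier → Carrier → Set
  x ≤ y = Defs._≤_ F x y

  _-_ : Carrier → Carrier → Carrier
  x - y = Defs._-_ F x y

  _/_ : Carrier → Carrier → Carrier
  x / y = Defs._/_ F x y

  ∣_∣ : Carrier → Carrier
  ∣ x ∣ = Defs.∣_∣ F x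

  ℕ→F : ℕ → Carrier
  ℕ→F = fromℕ F

  sum : ∀ {n} → (Fin n → Carrier) → Carrier
  sum = Defs.sumF F

  ⟨_,_⟩ : ∀ {n} → Vect F n → Vect F n → Carrier
  ⟨ q , v ⟩ = Defs.⟨_,_⟩ F q v

  ≤-reflexive : ∀ {x y} → x ≡ y → x ≤ y
  ≤-reflexive = inj₂

  <⇒≱ : ∀ {x y} → x < y → ¬ (y ≤ x)
  <⇒≱ x<y y≤x = <-irrefl refl (begin-strict _ <⟨ x<y ⟩ _ ≤⟨ y≤x ⟩ _ ∎)

  +-monoˡ-< : ∀ {x y} z → x < y → x + z < y + z
  +-monoˡ-< z x<y = +-mono-< _ _ z x<y

  +-monoʳ-< : ∀ {x y} z → x < y → z + x < z + y
  +-monoʳ-< {x} {y} z x<y = subst₂ _<_ (+-comm x z) (+-comm y z) (+-monoˡ-< z x<y)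
    where open IsCommutativeRing isCommutativeRing using (+-comm)

  +-monoˡ-≤ : ∀ {x y} z → x ≤ y → x + z ≤ y + z
  +-monoˡ-≤ z (inj₁ x<y) = inj₁ (+-monoˡ-< z x<y)
  +-monoˡ-≤ z (inj₂ refl) = inj₂ refl

  +-monoʳ-≤ : ∀ {x y} z → x ≤ y → z + x ≤ z + y
  +-monoʳ-≤ z (inj₁ x<y) = inj₁ (+-monoʳ-< z x<y)
  +-monoʳ-≤ z (inj₂ refl) = inj₂ refl

  +-mono-≤ : ∀ {x y u v} → x ≤ y → u ≤ v → x + u ≤ y + v
  +-mono-≤ {x} {y} {u} {v} x≤y u≤v = begin
    x + u ≤⟨ +-monoˡ-≤ u x≤y ⟩
    y + u ≤⟨ +-monoʳ-≤ y u≤v ⟩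
    y + v ∎

  -‿antitone-< : ∀ {x y} → x < y → - y < - x
  -‿antitone-< {x} {y} x<y = begin-strict
    - y              ≡⟨ solve 2 (λ x y → :- y := x :+ (:- x :+ :- y)) refl x y ⟩
    x + (- x + - y)  <⟨ +-monoˡ-< (- x + - y) x<y ⟩
    y + (- x + - y)  ≡⟨ solve 2 (λ x y → y :+ (:- x :+ :- y) := :- x) refl x y ⟩
    - x              ∎

  -‿antitone-≤ : ∀ {x y} → x ≤ y → - y ≤ - x
  -‿antitone-≤ (inj₁ x<y) = inj₁ (-‿antitone-< x<y)
  -‿antitone-≤ (inj₂ refl) = inj₂ refl

  -0≡0 : - 0# ≡ 0#
  -0≡0 = solve 0 (:- con (0 , 0) := con (0 , 0)) refl

  neg⇒-pos : ∀ {x} → x < 0# → 0# < - x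
  neg⇒-pos x<0 = subst (_< _) -0≡0 (-‿antitone-< x<0)

  -- multiplication by a positive (resp. nonnegative) element is monotone,
  -- since (y - x) z > 0 for y > x and z > 0
  *-monoʳ-< : ∀ {x y z} → 0# < z → x < y → x * z < y * z
  *-monoʳ-< {x} {y} {z} 0<z x<y = begin-strict
    x * z               ≡⟨ solve 2 (λ x z → x :* z := con (0 , 0) :+ x :* z) refl x z ⟩
    0# + x * z          <⟨ +-monoˡ-< (x * z) (*-pos (y - x) z 0<y-x 0<z) ⟩
    (y - x) * z + x * z ≡⟨ solve 3 (λ x y z → (y :+ :- x) :* z :+ x :* z := y :* z) refl x y z ⟩
    y * z               ∎
    where
    0<y-x : 0# < y - x
    0<y-x = subst (_< y - x) (solve 1 (λ x → x :+ :- x := con (0 , 0)) refl x) (+-monoˡ-< (- x) x<y)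

  *-monoʳ-≤ : ∀ {x y z} → 0# ≤ z → x ≤ y → x * z ≤ y * z
  *-monoʳ-≤ _          (inj₂ refl) = inj₂ refl
  *-monoʳ-≤ (inj₁ 0<z) (inj₁ x<y)  = inj₁ (*-monoʳ-< 0<z x<y)
  *-monoʳ-≤ {x} {y} (inj₂ refl) (inj₁ _) = inj₂ (trans (x*0≡0 x) (sym (x*0≡0 y)))
    where
    x*0≡0 : ∀ x → x * 0# ≡ 0#
    x*0≡0 = solve 1 (λ x → x :* con (0 , 0) := con (0 , 0)) refl

  *-monoˡ-≤ : ∀ {x y z} → 0# ≤ z → x ≤ y → z * x ≤ z * y
  *-monoˡ-≤ {x} {y} {z} 0≤z x≤y = subst₂ _≤_ (*-comm x z) (*-comm y z) (*-monoʳ-≤ 0≤z x≤y)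
    where open IsCommutativeRing isCommutativeRing using (*-comm)

  *-nonneg : ∀ {x y} → 0# ≤ x → 0# ≤ y → 0# ≤ x * y
  *-nonneg {x} {y} 0≤x 0≤y =
    subst (_≤ x * y) (solve 1 (λ y → con (0 , 0) :* y := con (0 , 0)) refl y) (*-monoʳ-≤ 0≤y 0≤x)

  x*x-nonneg : ∀ x → 0# ≤ x * x
  x*x-nonneg x with compare x 0#
  ... | tri< x<0 _ _  = inj₁ (subst (0# <_) (solve 1 (λ x → (:- x) :* (:- x) := x :* x) refl x)
                                     (*-pos _ _ (neg⇒-pos x<0) (neg⇒-pos x<0)))
  ... | tri≈ _ refl _ = inj₂ (solve 0 (con (0 , 0) := con (0 , 0) :* con (0 , 0)) refl)
  ... | tri> _ _ 0<x  = inj₁ (*-pos _ _ 0<x 0<x)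

  -- 1 ≠ 0, and 1 = (-1)·(-1) is a square
  0<1 : 0# < 1#
  0<1 with compare 0# 1#
  ... | tri< 0<1 _ _ = 0<1
  ... | tri≈ _ 0≡1 _ = ⊥-elim (0≢1 0≡1)
  ... | tri> _ _ 1<0 = ⊥-elim (<⇒≱ 1<0 (subst (0# ≤_) (-1*-1≡1) (x*x-nonneg (- 1#))))
    where
    -1*-1≡1 : - 1# * - 1# ≡ 1#
    -1*-1≡1 = solve 0 ((:- con (1 , 0)) :* (:- con (1 , 0)) := con (1 , 0)) refl

  ℕ→F-nonneg : ∀ k → 0# ≤ ℕ→F k
  ℕ→F-suc-pos : ∀ k → 0# < ℕ→F (suc k)
  ℕ→F-nonneg zero    = inj₂ refl
  ℕ→F-nonneg (suc k) = inj₁ (ℕ→F-suc-pos k)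
  ℕ→F-suc-pos k = begin-strict
    0#         ≡⟨ solve 0 (con (0 , 0) := con (0 , 0) :+ con (0 , 0)) refl ⟩
    0# + 0#    <⟨ +-monoˡ-< 0# 0<1 ⟩
    1# + 0#    ≤⟨ +-monoʳ-≤ 1# (ℕ→F-nonneg k) ⟩
    1# + ℕ→F k ∎

  pos⇒≢0 : ∀ {x} → 0# < x → x ≢ 0#
  pos⇒≢0 0<x refl = <-irrefl refl 0<x

  -- x⁻¹ ≤ 0 for x > 0 would make 1 = x·x⁻¹ nonpositive
  ⁻¹-pos : ∀ {x} → 0# < x → 0# < x ⁻¹
  ⁻¹-pos {x} 0<x with compare (x ⁻¹) 0#
  ... | tri> _ _ 0<x⁻¹ = 0<x⁻¹
  ... | tri≈ _ x⁻¹≡0 _ = ⊥-elim (0≢1 (begin-equality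
    0#       ≡⟨ solve 1 (λ x → con (0 , 0) := x :* con (0 , 0)) refl x ⟩
    x * 0#   ≡⟨ cong (x *_) x⁻¹≡0 ⟨
    x * x ⁻¹ ≡⟨ ⁻¹-inverse x (pos⇒≢0 0<x) ⟩
    1#       ∎))
  ... | tri< x⁻¹<0 _ _ = ⊥-elim (<-irrefl refl (begin-strict
    0#           <⟨ *-pos _ _ 0<x (neg⇒-pos x⁻¹<0) ⟩
    x * - (x ⁻¹) ≡⟨ solve 2 (λ x y → x :* (:- y) := :- (x :* y)) refl x (x ⁻¹) ⟩
    - (x * x ⁻¹) ≡⟨ cong -_ (⁻¹-inverse x (pos⇒≢0 0<x)) ⟩
    - 1#         <⟨ -‿antitone-< 0<1 ⟩
    - 0#         ≡⟨ -0≡0 ⟩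
    0#           ∎))

  ≤-∣∣-cases : ∀ {a} x → a ≤ ∣ x ∣ → a ≤ x ⊎ a ≤ - x
  ≤-∣∣-cases x a≤∣x∣ with compare x 0#
  ... | tri< _ _ _ = inj₂ a≤∣x∣
  ... | tri≈ _ _ _ = inj₁ a≤∣x∣
  ... | tri> _ _ _ = inj₁ a≤∣x∣

  ∣∣-<-bounds : ∀ {a} x → ∣ x ∣ < a → x < a × - x < a
  ∣∣-<-bounds {a} x ∣x∣<a with compare x 0#
  ... | tri< x<0 _ _  = (begin-strict x <⟨ x<0 ⟩ 0# <⟨ neg⇒-pos x<0 ⟩ - x <⟨ ∣x∣<a ⟩ a ∎) , ∣x∣<a
  ... | tri≈ _ refl _ = ∣x∣<a , subst (_< a) (sym -0≡0) ∣x∣<a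
  ... | tri> _ _ 0<x  = ∣x∣<a , (begin-strict - x <⟨ -‿antitone-< 0<x ⟩ - 0# ≡⟨ -0≡0 ⟩ 0# <⟨ 0<x ⟩ x <⟨ ∣x∣<a ⟩ a ∎)

  ∣x-x∣<pos : ∀ {α} x → 0# < α → ¬ (α ≤ ∣ x - x ∣)
  ∣x-x∣<pos x 0<α α≤∣x-x∣ with ≤-∣∣-cases (x - x) α≤∣x-x∣
  ... | inj₁ α≤x-x    = <⇒≱ 0<α (subst (_ ≤_) (solve 1 (λ x → x :+ :- x := con (0 , 0)) refl x) α≤x-x)
  ... | inj₂ α≤-[x-x] = <⇒≱ 0<α (subst (_ ≤_) (solve 1 (λ x → :- (x :+ :- x) := con (0 , 0)) refl x) α≤-[x-x])

  solve-for-count : ∀ {x S α N} → 0# < α → 0# < N → x * (α / N * α) ≤ S → x ≤ (S * N) / (α * α)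
  solve-for-count {x} {S} {α} {N} 0<α 0<N xK≤S = begin
    x                                     ≡⟨ solve 1 (λ x → x := x :* (con (1 , 0) :* con (1 , 0))) refl x ⟩
    x * (1# * 1#)                         ≡⟨ cong₂ (λ u w → x * (u * w)) (⁻¹-inverse (α * α) (pos⇒≢0 0<α²))
                                                                        (⁻¹-inverse N (pos⇒≢0 0<N)) ⟨
    x * ((α * α) * (α * α) ⁻¹ * (N * N ⁻¹)) ≡⟨ solve 5 (λ x α i N j → x :* ((α :* α) :* j :* (N :* i))
                                                                 := x :* ((α :* i) :* α) :* (N :* j))
                                                 refl x α (N ⁻¹) N ((α * α) ⁻¹) ⟩
    x * (α / N * α) * (N / (α * α))       ≤⟨ *-monoʳ-≤ (inj₁ (*-pos _ _ 0<N (⁻¹-pos 0<α²))) xK≤S ⟩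
    S * (N / (α * α))                     ≡⟨ solve 3 (λ S N j → S :* (N :* j) := (S :* N) :* j) refl S N ((α * α) ⁻¹) ⟩
    (S * N) / (α * α)                     ∎
    where
    0<α² : 0# < α * α
    0<α² = *-pos _ _ 0<α 0<α

  telescope : ∀ (φ : ℕ → Carrier) K k → (∀ t → t ℕ.< k → φ (suc t) + K ≤ φ t) → ℕ→F k * K + φ k ≤ φ 0
  telescope φ K zero    _     = ≤-reflexive (solve 2 (λ K p → con (0 , 0) :* K :+ p := p) refl K (φ 0))
  telescope φ K (suc k) drops = begin
    (1# + ℕ→F k) * K + φ (suc k) ≡⟨ solve 3 (λ n K p → (con (1 , 0) :+ n) :* K :+ p := n :* K :+ (p :+ K))
                                           refl (ℕ→F k) K (φ (suc k)) ⟩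
    ℕ→F k * K + (φ (suc k) + K)  ≤⟨ +-monoʳ-≤ (ℕ→F k * K) (drops k (ℕ.n<1+n k)) ⟩
    ℕ→F k * K + φ k              ≤⟨ telescope φ K k (λ t t<k → drops t (ℕ.m<n⇒m<1+n t<k)) ⟩
    φ 0                          ∎

  sum-cong : ∀ {n} {f g : Fin n → Carrier} → (∀ i → f i ≡ g i) → sum f ≡ sum g
  sum-cong {zero}  f≗g = refl
  sum-cong {suc n} f≗g = cong₂ _+_ (f≗g zero) (sum-cong (λ i → f≗g (suc i)))

  sum-+ : ∀ {n} (f g : Fin n → Carrier) → sum (λ i → f i + g i) ≡ sum f + sum g
  sum-+ {zero}  f g = solve 0 (con (0 , 0) := con (0 , 0) :+ con (0 , 0)) refl
  sum-+ {suc n} f g = trans (cong (f zero + g zero +_) (sum-+ (λ i → f (suc i)) (λ i → g (suc i))))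
                            (solve 4 (λ a b c d → a :+ b :+ (c :+ d) := a :+ c :+ (b :+ d)) refl _ _ _ _)

  sum-- : ∀ {n} (f g : Fin n → Carrier) → sum (λ i → f i - g i) ≡ sum f - sum g
  sum-- {zero}  f g = solve 0 (con (0 , 0) := con (0 , 0) :+ :- con (0 , 0)) refl
  sum-- {suc n} f g = trans (cong (f zero - g zero +_) (sum-- (λ i → f (suc i)) (λ i → g (suc i))))
                            (solve 4 (λ a b c d → a :+ :- b :+ (c :+ :- d) := a :+ c :+ :- (b :+ d)) refl _ _ _ _)

  sum-scale : ∀ {n} k (f : Fin n → Carrier) → sum (λ i → k * f i) ≡ k * sum f
  sum-scale {zero}  k f = solve 1 (λ k → con (0 , 0) := k :* con (0 , 0)) refl k
  sum-scale {suc n} k f = trans (cong (k * f zero +_) (sum-scale k (λ i → f (suc i))))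
                                (solve 3 (λ k a b → k :* a :+ k :* b := k :* (a :+ b)) refl _ _ _)

  sum-mono : ∀ {n} {f g : Fin n → Carrier} → (∀ i → f i ≤ g i) → sum f ≤ sum g
  sum-mono {zero}  f≤g = ≤-reflexive refl
  sum-mono {suc n} f≤g = +-mono-≤ (f≤g zero) (sum-mono (λ i → f≤g (suc i)))

  sum-nonneg : ∀ {n} {f : Fin n → Carrier} → (∀ i → 0# ≤ f i) → 0# ≤ sum f
  sum-nonneg {n} {f} 0≤f = subst (_≤ sum f) (sum-zeros n) (sum-mono 0≤f)
    where
    sum-zeros : ∀ n → sum {n} (λ _ → 0#) ≡ 0#
    sum-zeros zero    = refl
    sum-zeros (suc n) = trans (cong (0# +_) (sum-zeros n)) (solve 0 (con (0 , 0) :+ con (0 , 0) := con (0 , 0)) refl)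

  sum-ones : ∀ n → sum {n} (λ _ → 1#) ≡ ℕ→F n
  sum-ones zero    = refl
  sum-ones (suc n) = cong (1# +_) (sum-ones n)

module FriezeKannanPotential (F : OrderedField) where
  open OrderedField F
  open ≡ using (_≡_; _≢_; refl; sym; cong; cong₂; subst)
  open IsStrictTotalOrder isStrictTotalOrder using (compare)
  open OrderedFieldProperties F
  open IntegerCoefficientSolver commutativeRing using (solve; _:+_; _:*_; :-_; _:=_; con)
  open import Relation.Binary.Reasoning.StrictPartialOrder (StrictTotalOrder.strictPartialOrder strictTotalOrder)

  -- A linear query has ⟨ Q , Q ⟩ ≤ n, since Qᵢ² ≤ Qᵢ ≤ 1 for Qᵢ ∈ [0,1].
  linearQuery-selfProduct : ∀ {n} (Q : Vect F n) → IsLinearQuery F Q → ⟨ Q , Q ⟩ ≤ ℕ→F n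
  linearQuery-selfProduct {n} Q Q∈[0,1] = begin
    sum (λ i → Q i * Q i) ≤⟨ sum-mono Qᵢ²≤1 ⟩
    sum {n} (λ _ → 1#)    ≡⟨ sum-ones n ⟩
    ℕ→F n                 ∎
    where
    Qᵢ²≤1 : ∀ i → Q i * Q i ≤ 1#
    Qᵢ²≤1 i = let (0≤Qᵢ , Qᵢ≤1) = Q∈[0,1] i in begin
      Q i * Q i ≤⟨ *-monoʳ-≤ 0≤Qᵢ Qᵢ≤1 ⟩
      1# * Q i  ≡⟨ solve 1 (λ q → con (1 , 0) :* q := q) refl (Q i) ⟩
      Q i       ≤⟨ Qᵢ≤1 ⟩
      1#        ∎

  dist² : ∀ {n} → Vect F n → Vect F n → Carrier
  dist² x y = sum (λ i → (x i - y i) * (x i - y i))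

  translate : ∀ {n} → Vect F n → Carrier → Vect F n → Vect F n
  translate v e q i = v i + e * q i

  dist²-congʳ : ∀ {n} (x : Vect F n) {y z : Vect F n} → (∀ i → y i ≡ z i) → dist² x y ≡ dist² x z
  dist²-congʳ x y≗z = sum-cong (λ i → cong (λ t → (x i - t) * (x i - t)) (y≗z i))

  dist²-nonneg : ∀ {n} (x y : Vect F n) → 0# ≤ dist² x y
  dist²-nonneg x y = sum-nonneg (λ i → x*x-nonneg (x i - y i))

  dist²-translate : ∀ {n} (x y q : Vect F n) e →
    dist² x (translate y e q) ≡ dist² x y - (e + e) * (⟨ q , x ⟩ - ⟨ q , y ⟩) + e * e * ⟨ q , q ⟩
  dist²-translate {n} x y q e = begin-equality
    dist² x (translate y e q)
      ≡⟨ sum-cong (λ i → expand (x i) (y i) (q i)) ⟩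
    sum (λ i → (sq i - (e + e) * cross i) + e * e * (q i * q i))
      ≡⟨ sum-+ (λ i → sq i - (e + e) * cross i) (λ i → e * e * (q i * q i)) ⟩
    sum (λ i → sq i - (e + e) * cross i) + sum (λ i → e * e * (q i * q i))
      ≡⟨ cong₂ _+_ (sum-- sq (λ i → (e + e) * cross i)) (sum-scale (e * e) (λ i → q i * q i)) ⟩
    dist² x y - sum (λ i → (e + e) * cross i) + e * e * ⟨ q , q ⟩
      ≡⟨ cong (λ t → dist² x y - t + e * e * ⟨ q , q ⟩) (sum-scale (e + e) cross) ⟩
    dist² x y - (e + e) * sum cross + e * e * ⟨ q , q ⟩
      ≡⟨ cong (λ t → dist² x y - (e + e) * t + e * e * ⟨ q , q ⟩) (sum-- (λ i → q i * x i) (λ i → q i * y i)) ⟩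
    dist² x y - (e + e) * (⟨ q , x ⟩ - ⟨ q , y ⟩) + e * e * ⟨ q , q ⟩ ∎
    where
    sq cross : Fin n → Carrier
    sq i    = (x i - y i) * (x i - y i)
    cross i = q i * x i - q i * y i
    expand : ∀ a b c → (a - (b + e * c)) * (a - (b + e * c))
                       ≡ ((a - b) * (a - b) - (e + e) * (c * a - c * b)) + e * e * (c * c)
    expand = solve 4 (λ e a b c →
      (a :+ :- (b :+ e :* c)) :* (a :+ :- (b :+ e :* c))
        := ((a :+ :- b) :* (a :+ :- b) :+ :- ((e :+ e) :* (c :* a :+ :- (c :* b)))) :+ e :* e :* (c :* c))
      refl e

  dist²-descent : ∀ {n} (x y q : Vect F n) e K →
    K ≤ e * (⟨ q , x ⟩ - ⟨ q , y ⟩) → e * e * ⟨ q , q ⟩ ≤ K → dist² x (translate y e q) + K ≤ dist² x y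
  dist²-descent x y q e K K≤eδ e²q²≤K = begin
    dist² x (translate y e q) + K
      ≡⟨ cong (_+ K) (dist²-translate x y q e) ⟩
    dist² x y - (e + e) * δ + e * e * ⟨ q , q ⟩ + K
      ≡⟨ cong (λ t → t + e * e * ⟨ q , q ⟩ + K) (double (dist² x y) e δ) ⟩
    dist² x y + (- (e * δ) + - (e * δ)) + e * e * ⟨ q , q ⟩ + K
      ≤⟨ +-monoˡ-≤ K (+-mono-≤ (+-monoʳ-≤ (dist² x y) (+-mono-≤ (-‿antitone-≤ K≤eδ) (-‿antitone-≤ K≤eδ))) e²q²≤K) ⟩
    dist² x y + (- K + - K) + K + K
      ≡⟨ solve 2 (λ p k → p :+ (:- k :+ :- k) :+ k :+ k := p) refl (dist² x y) K ⟩
    dist² x y ∎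
    where
    δ : Carrier
    δ = ⟨ q , x ⟩ - ⟨ q , y ⟩
    double : ∀ p e δ → p - (e + e) * δ ≡ p + (- (e * δ) + - (e * δ))
    double = solve 3 (λ p e δ → p :+ :- ((e :+ e) :* δ) := p :+ (:- (e :* δ) :+ :- (e :* δ))) refl

  -- Let t be the true answer of a query, s its
  -- answer on the current data structure and a the noisy answer, with
  -- α ≤ ∣ t - s ∣ (the query is badly answered: condition (2)) and
  -- ∣ t - a ∣ < α (the noisy answer is accurate: condition (3)).  Then the
  -- sign of s - a, which the FK rule inspects, is the sign of s - t.

  overshoot : ∀ {α} t s a → α ≤ ∣ t - s ∣ → ∣ t - a ∣ < α → 0# < s - a → α ≤ - (t - s)
  overshoot {α} t s a α≤∣t-s∣ ∣t-a∣<α 0<s-a with ≤-∣∣-cases (t - s) α≤∣t-s∣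
  ... | inj₂ α≤-[t-s] = α≤-[t-s]
  ... | inj₁ α≤t-s    = ⊥-elim (<⇒≱ (proj₁ (∣∣-<-bounds (t - a) ∣t-a∣<α)) (begin
    α                 ≤⟨ α≤t-s ⟩
    t - s             ≡⟨ solve 1 (λ x → x := x :+ con (0 , 0)) refl (t - s) ⟩
    (t - s) + 0#      <⟨ +-monoʳ-< (t - s) 0<s-a ⟩
    (t - s) + (s - a) ≡⟨ solve 3 (λ t s a → (t :+ :- s) :+ (s :+ :- a) := t :+ :- a) refl t s a ⟩
    t - a             ∎))

  undershoot : ∀ {α} t s a → α ≤ ∣ t - s ∣ → ∣ t - a ∣ < α → s - a < 0# → α ≤ t - s
  undershoot {α} t s a α≤∣t-s∣ ∣t-a∣<α s-a<0 with ≤-∣∣-cases (t - s) α≤∣t-s∣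
  ... | inj₁ α≤t-s    = α≤t-s
  ... | inj₂ α≤-[t-s] = ⊥-elim (<⇒≱ (proj₂ (∣∣-<-bounds (t - a) ∣t-a∣<α)) (begin
    α                     ≤⟨ α≤-[t-s] ⟩
    - (t - s)             ≡⟨ solve 1 (λ x → x := x :+ con (0 , 0)) refl (- (t - s)) ⟩
    - (t - s) + 0#        <⟨ +-monoʳ-< (- (t - s)) (neg⇒-pos s-a<0) ⟩
    - (t - s) + - (s - a) ≡⟨ solve 3 (λ t s a → :- (t :+ :- s) :+ :- (s :+ :- a) := :- (t :+ :- a)) refl t s a ⟩
    - (t - a)             ∎))

  not-exact : ∀ {α} t s a → α ≤ ∣ t - s ∣ → ∣ t - a ∣ < α → s - a ≢ 0#
  not-exact t s a α≤∣t-s∣ ∣t-a∣<α s-a≡0 = <⇒≱ ∣t-a∣<α (subst (λ u → _ ≤ ∣ t - u ∣) s≡a α≤∣t-s∣)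
    where
    s≡a : s ≡ a
    s≡a = begin-equality
      s           ≡⟨ solve 2 (λ s a → s := (s :+ :- a) :+ a) refl s a ⟩
      (s - a) + a ≡⟨ cong (_+ a) s-a≡0 ⟩
      0# + a      ≡⟨ solve 1 (λ a → con (0 , 0) :+ a := a) refl a ⟩
      a           ∎

  fkStep-cases : ∀ {n} α (v Q : Vect F n) â →
      (0# < ⟨ Q , v ⟩ - â × (∀ i → stepFK F α v Q â i ≡ translate v (- (α / ℕ→F n)) Q i))
    ⊎ (⟨ Q , v ⟩ - â < 0# × (∀ i → stepFK F α v Q â i ≡ translate v (α / ℕ→F n) Q i))
    ⊎ ⟨ Q , v ⟩ - â ≡ 0#
  fkStep-cases {n} α v Q â with compare (⟨ Q , v ⟩ - â) 0#
  ... | tri> _ _ 0<s-a = inj₁ (0<s-a , λ i →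
          solve 3 (λ x c q → x :+ :- (c :* q) := x :+ (:- c) :* q) refl (v i) (α / ℕ→F n) (Q i))
  ... | tri< s-a<0 _ _ = inj₂ (inj₁ (s-a<0 , λ i → refl))
  ... | tri≈ _ s-a≡0 _ = inj₂ (inj₂ s-a≡0)

  fkStepSize-nonneg : ∀ {n α} → 0# < ℕ→F n → 0# < α → 0# ≤ α / ℕ→F n
  fkStepSize-nonneg 0<N 0<α = inj₁ (*-pos _ _ 0<α (⁻¹-pos 0<N))

  fkStep-length² : ∀ {n α} (Q : Vect F n) → 0# < ℕ→F n → IsLinearQuery F Q →
    (α / ℕ→F n) * (α / ℕ→F n) * ⟨ Q , Q ⟩ ≤ (α / ℕ→F n) * α
  fkStep-length² {n} {α} Q 0<N Q-linear = begin
    c * c * ⟨ Q , Q ⟩  ≤⟨ *-monoˡ-≤ (x*x-nonneg c) (linearQuery-selfProduct Q Q-linear) ⟩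
    c * c * N          ≡⟨ solve 3 (λ α i N → (α :* i) :* (α :* i) :* N := (α :* i) :* α :* (N :* i))
                                  refl α (N ⁻¹) N ⟩
    c * α * (N * N ⁻¹) ≡⟨ cong (c * α *_) (⁻¹-inverse N (pos⇒≢0 0<N)) ⟩
    c * α * 1#         ≡⟨ solve 1 (λ x → x :* con (1 , 0) := x) refl (c * α) ⟩
    c * α              ∎
    where
    N c : Carrier
    N = ℕ→F n
    c = α / N

  fkStep-descent : ∀ {n α} (d v Q : Vect F n) â → 0# < ℕ→F n → 0# < α → IsLinearQuery F Q →
    α ≤ ∣ ⟨ Q , d ⟩ - ⟨ Q , v ⟩ ∣ → ∣ ⟨ Q , d ⟩ - â ∣ < α →
    dist² d (stepFK F α v Q â) + α / ℕ→F n * α ≤ dist² d v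
  fkStep-descent {n} {α} d v Q â 0<N 0<α Q-linear badly accurate with fkStep-cases α v Q â
  ... | inj₁ (0<s-a , step≗) =
    subst (λ u → u + α / ℕ→F n * α ≤ dist² d v) (sym (dist²-congʳ d step≗))
      (dist²-descent d v Q (- (α / ℕ→F n)) (α / ℕ→F n * α)
        (subst (α / ℕ→F n * α ≤_) (solve 2 (λ c δ → c :* (:- δ) := (:- c) :* δ) refl (α / ℕ→F n) _)
          (*-monoˡ-≤ (fkStepSize-nonneg {n} 0<N 0<α) (overshoot _ _ â badly accurate 0<s-a)))
        (subst (_≤ α / ℕ→F n * α) (solve 2 (λ c x → c :* c :* x := (:- c) :* (:- c) :* x) refl (α / ℕ→F n) ⟨ Q , Q ⟩)
          (fkStep-length² {α = α} Q 0<N Q-linear)))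
  ... | inj₂ (inj₁ (s-a<0 , step≗)) =
    subst (λ u → u + α / ℕ→F n * α ≤ dist² d v) (sym (dist²-congʳ d step≗))
      (dist²-descent d v Q (α / ℕ→F n) (α / ℕ→F n * α)
        (*-monoˡ-≤ (fkStepSize-nonneg {n} 0<N 0<α) (undershoot _ _ â badly accurate s-a<0))
        (fkStep-length² {α = α} Q 0<N Q-linear))
  ... | inj₂ (inj₂ s-a≡0) = ⊥-elim (not-exact _ _ â badly accurate s-a≡0)

  updateSequence-potential : ∀ {n} (D : Fin n → ℕ) (𝒬 : Vect F n → Set) → (∀ Q → 𝒬 Q → IsLinearQuery F Q) →
    ∀ {α} → 0# < α → 0# < ℕ→F n →
    ∀ C (Ds Qs : ℕ → Vect F n) (as : ℕ → Carrier) → IsFKUpdateSequence F D 𝒬 α C Ds Qs as →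
    ℕ→F C * (α / ℕ→F n * α) ≤ sqNorm F D
  updateSequence-potential {n} D 𝒬 linear {α} 0<α 0<N C Ds Qs as sequence = begin
    ℕ→F C * K          ≡⟨ solve 1 (λ x → x := x :+ con (0 , 0)) refl (ℕ→F C * K) ⟩
    ℕ→F C * K + 0#     ≤⟨ +-monoʳ-≤ (ℕ→F C * K) (dist²-nonneg d (trajectory C)) ⟩
    ℕ→F C * K + φ C    ≤⟨ telescope φ K C descends ⟩
    φ 0                ≡⟨ cong (dist² d) cond1 ⟩
    dist² d (initFK F) ≡⟨ sum-cong (λ i → solve 1 (λ x → (x :+ :- con (0 , 0)) :* (x :+ :- con (0 , 0)) := x :* x)
                                                 refl (d i)) ⟩
    sqNorm F D         ∎
    where
    open IsFKUpdateSequence sequence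
    d : Vect F n
    d = embedDB F D
    K : Carrier
    K = α / ℕ→F n * α

    -- the data structures D⁽¹⁾, D⁽²⁾, …, each followed by one FK step
    trajectory : ℕ → Vect F n
    trajectory zero    = Ds 1
    trajectory (suc t) = stepFK F α (Ds (suc t)) (Qs (suc t)) (as (suc t))

    trajectory-on-sequence : ∀ t → suc t ℕ.≤ C → trajectory t ≡ Ds (suc t)
    trajectory-on-sequence zero    _     = refl
    trajectory-on-sequence (suc t) t+2≤C = sym (cond4 (suc t) (ℕ.s≤s ℕ.z≤n) (ℕ.∸-monoˡ-≤ 1 t+2≤C))

    φ : ℕ → Carrier
    φ t = dist² d (trajectory t)

    descends : ∀ t → t ℕ.< C → φ (suc t) + K ≤ φ t
    descends t t<C = subst (λ v → φ (suc t) + K ≤ dist² d v) (sym (trajectory-on-sequence t t<C))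
      (fkStep-descent d (Ds (suc t)) (Qs (suc t)) (as (suc t)) 0<N 0<α
        (linear (Qs (suc t)) (queries-in-𝒬 (suc t) (ℕ.s≤s ℕ.z≤n) t<C))
        (cond2 (suc t) (ℕ.s≤s ℕ.z≤n) t<C) (cond3 (suc t) (ℕ.s≤s ℕ.z≤n) t<C))

  -- B(α) = ‖D‖² n / α² is nonnegative, which bounds the empty sequence.
  B-nonneg : ∀ {n} (D : Fin n → ℕ) {α} → 0# < α → 0# ≤ B F D α
  B-nonneg {n} D 0<α = *-nonneg (*-nonneg (sum-nonneg {n} (λ i → x*x-nonneg (ℕ→F (D i)))) (ℕ→F-nonneg n))
                                (inj₁ (⁻¹-pos (*-pos _ _ 0<α 0<α)))

open Defs using (_≤_)

mainTheorem3 : (F : OrderedField) → let open OrderedField F in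
    (n : ℕ) (D : Fin n → ℕ) (𝒬 : Vect F n → Set) →
    (∀ Q → 𝒬 Q → IsLinearQuery F Q) →
    (α : Carrier) → 0# < α →
    (C : ℕ) (Ds : ℕ → Vect F n) (Qs : ℕ → Vect F n) (as : ℕ → Carrier) →
    IsFKUpdateSequence F D 𝒬 α C Ds Qs as →
    _≤_ F (fromℕ F C) (B F D α)
mainTheorem3 F n D 𝒬 linear α 0<α zero Ds Qs as sequence =
  FriezeKannanPotential.B-nonneg F D 0<α
-- over an empty universe every query answers 0, so condition (2) fails
mainTheorem3 F zero D 𝒬 linear α 0<α (suc C) Ds Qs as sequence =
  ⊥-elim (OrderedFieldProperties.∣x-x∣<pos F _ 0<α (IsFKUpdateSequence.cond2 sequence 1 (ℕ.s≤s ℕ.z≤n) (ℕ.s≤s ℕ.z≤n)))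
mainTheorem3 F (suc m) D 𝒬 linear α 0<α C@(suc _) Ds Qs as sequence =
  solve-for-count 0<α (ℕ→F-suc-pos m)
    (FriezeKannanPotential.updateSequence-potential F D 𝒬 linear 0<α (ℕ→F-suc-pos m) C Ds Qs as sequence)
  where open OrderedFieldProperties F
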